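{- Let $(W_r)_{r\in\mathbb{Z}}$ be a generalized Tribonacci sequence. For every integer $r$, \[ W_{r-16}=-103W_r+56W_{r+1},\qquad 2W_{r-17}=9W_r-103W_{r-4},\qquad W_{r-14}=9W_{r+2}-56W_{r-1}. \]
   Context: Let $W_0,W_1,W_2$ be arbitrary integers, not all zero. The generalized Tribonacci numbers $(W_r)_{r\in\mathbb{Z}}$ are defined by $W_r=W_{r-1}+W_{r-2}+W_{r-3}$ for $r\ge 3$, and extended to negative indices by $W_{ -r}=W_{ -r+3}-W_{ -r+2}-W_{ -r+1}$ (so the recurrence holds for all $r\in\mathbb{Z}$). -}

module Defs where

open import Data.Nat using (ℕ; zero; suc)
open import Data.Integer using (ℤ; +_; -[1+_]; _+_; _-_)
open import Data.Product using (_×_; _,_; proj₁)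

-- Triples (W_k , W_{k+1} , W_{k+2}).
Triple : Set
Triple = ℤ × ℤ × ℤ

fwdStep : Triple → Triple
fwdStep (a , b , c) = (b , c , c + b + a)

bwdStep : Triple → Triple
bwdStep (a , b , c) = (c - b - a , a , b)

iter : (Triple → Triple) → ℕ → Triple → Triple
iter f zero t = t
iter f (suc n) t = f (iter f n t)

trib : ℤ → ℤ → ℤ → ℤ → ℤ
trib W₀ W₁ W₂ (+ n)      = proj₁ (iter fwdStep n (W₀ , W₁ , W₂))
trib W₀ W₁ W₂ (-[1+ n ]) = proj₁ (iter bwdStep (suc n) (W₀ , W₁ , W₂))

-- Every two-sided Tribonacci sequence is determined linearly by any three
-- consecutive terms: f (s + k) = f s · T₀ k + f (s + 1) · T₁ k + f (s + 2) · T₂ k,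
-- where T₀, T₁, T₂ are the Tribonacci sequences started from the unit vectors
-- (the window map (a, b, c) ↦ (b, c, a + b + c) is linear). Writing all terms of
-- an identity in the window at s = r - 17, each identity becomes a polynomial
-- identity in three variables with Tribonacci numbers as coefficients.
module Submission where

open import Defs
open import Data.Nat using (zero; suc)
import Data.Nat as ℕ
import Data.Nat.Properties as ℕ
open import Data.Integer using (ℤ; +_; _+_; _-_; _*_; -_; -[1+_])
import Data.Integer.Properties as ℤ
open import Data.Integer.Tactic.RingSolver using (solve-∀)
open import Data.Product using (_×_; _,_; proj₁)
open import Relation.Nullary using (¬_)
open import Relation.Binary.PropositionalEquality
open ≡-Reasoning

Tribonacci : (ℤ → ℤ) → Set
Tribonacci f = ∀ r → f (r + + 3) ≡ f (r + + 2) + f (r + + 1) + f r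

iter-+ : ∀ (g : Triple → Triple) m n t → iter g (n ℕ.+ m) t ≡ iter g m (iter g n t)
iter-+ g m n t rewrite ℕ.+-comm n m = go m
  where
  go : ∀ m → iter g (m ℕ.+ n) t ≡ iter g m (iter g n t)
  go zero    = refl
  go (suc m) = cong g (go m)

bwdStep-recurrence : ∀ a b c → a ≡ b + c + (a - b - c)
bwdStep-recurrence = solve-∀

module _ (W₀ W₁ W₂ : ℤ) where

  private
    W : ℤ → ℤ
    W = trib W₀ W₁ W₂

  trib-tribonacci : Tribonacci W
  trib-tribonacci (+ n)
    rewrite iter-+ fwdStep 3 n (W₀ , W₁ , W₂)
          | iter-+ fwdStep 2 n (W₀ , W₁ , W₂)
          | iter-+ fwdStep 1 n (W₀ , W₁ , W₂) = refl
  trib-tribonacci -[1+ 0 ]                   = bwdStep-recurrence _ (W (+ 1)) (W (+ 0))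
  trib-tribonacci -[1+ 1 ]                   = bwdStep-recurrence _ (W (+ 0)) (W -[1+ 0 ])
  trib-tribonacci -[1+ 2 ]                   = bwdStep-recurrence _ (W -[1+ 0 ]) (W -[1+ 1 ])
  trib-tribonacci -[1+ suc (suc (suc n)) ] = bwdStep-recurrence _ (W -[1+ suc n ]) (W -[1+ suc (suc n) ])

window : (ℤ → ℤ) → ℤ → Triple
window f s = f s , f (s + + 1) , f (s + + 2)

module _ {f : ℤ → ℤ} (tri : Tribonacci f) where

  window-suc : ∀ s → window f (s + + 1) ≡ fwdStep (window f s)
  window-suc s = cong₂ (λ x y → f (s + + 1) , x , y)
    (cong f (ℤ.+-assoc s (+ 1) (+ 1)))
    (trans (cong f (ℤ.+-assoc s (+ 1) (+ 2))) (tri s))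

  window-shift : ∀ s k → window f (s + + k) ≡ iter fwdStep k (window f s)
  window-shift s zero    = cong (window f) (ℤ.+-identityʳ s)
  window-shift s (suc k) = begin
    window f (s + + suc k)          ≡⟨ cong (λ n → window f (s + + n)) (ℕ.+-comm 1 k) ⟩
    window f (s + (+ k + + 1))      ≡⟨ cong (window f) (ℤ.+-assoc s (+ k) (+ 1)) ⟨
    window f (s + + k + + 1)        ≡⟨ window-suc (s + + k) ⟩
    fwdStep (window f (s + + k))    ≡⟨ cong fwdStep (window-shift s k) ⟩
    iter fwdStep (suc k) (window f s) ∎

combine : ℤ → ℤ → ℤ → Triple → Triple → Triple → Triple
combine a b c (u₀ , u₁ , u₂) (v₀ , v₁ , v₂) (w₀ , w₁ , w₂) =
  a * u₀ + b * v₀ + c * w₀ , a * u₁ + b * v₁ + c * w₁ , a * u₂ + b * v₂ + c * w₂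

fwdStep-combine : ∀ a b c u v w →
  fwdStep (combine a b c u v w) ≡ combine a b c (fwdStep u) (fwdStep v) (fwdStep w)
fwdStep-combine a b c (u₀ , u₁ , u₂) (v₀ , v₁ , v₂) (w₀ , w₁ , w₂) =
  cong (λ z → _ , _ , z) (distrib a b c u₀ u₁ u₂ v₀ v₁ v₂ w₀ w₁ w₂)
  where
  distrib : ∀ a b c u₀ u₁ u₂ v₀ v₁ v₂ w₀ w₁ w₂ →
    (a * u₂ + b * v₂ + c * w₂) + (a * u₁ + b * v₁ + c * w₁) + (a * u₀ + b * v₀ + c * w₀)
      ≡ a * (u₂ + u₁ + u₀) + b * (v₂ + v₁ + v₀) + c * (w₂ + w₁ + w₀)
  distrib = solve-∀

iter-fwdStep-combine : ∀ k a b c u v w →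
  iter fwdStep k (combine a b c u v w)
    ≡ combine a b c (iter fwdStep k u) (iter fwdStep k v) (iter fwdStep k w)
iter-fwdStep-combine zero    a b c u v w = refl
iter-fwdStep-combine (suc k) a b c u v w =
  trans (cong fwdStep (iter-fwdStep-combine k a b c u v w)) (fwdStep-combine a b c _ _ _)

e₀ e₁ e₂ : Triple
e₀ = + 1 , + 0 , + 0
e₁ = + 0 , + 1 , + 0
e₂ = + 0 , + 0 , + 1

combine-unit : ∀ a b c → (a , b , c) ≡ combine a b c e₀ e₁ e₂
combine-unit a b c = cong₂ _,_ (unit₀ a b c) (cong₂ _,_ (unit₁ a b c) (unit₂ a b c))
  where
  unit₀ : ∀ a b c → a ≡ a * + 1 + b * + 0 + c * + 0
  unit₀ = solve-∀
  unit₁ : ∀ a b c → b ≡ a * + 0 + b * + 1 + c * + 0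
  unit₁ = solve-∀
  unit₂ : ∀ a b c → c ≡ a * + 0 + b * + 0 + c * + 1
  unit₂ = solve-∀

module _ (f : ℤ → ℤ) (tri : Tribonacci f) (s : ℤ) where

  private
    a b c : ℤ
    a = f s
    b = f (s + + 1)
    c = f (s + + 2)

  tribonacci-expansion : ∀ k → f (s + + k) ≡
      f s * trib (+ 1) (+ 0) (+ 0) (+ k)
    + f (s + + 1) * trib (+ 0) (+ 1) (+ 0) (+ k)
    + f (s + + 2) * trib (+ 0) (+ 0) (+ 1) (+ k)
  tribonacci-expansion k = cong proj₁ (begin
    window f (s + + k)                  ≡⟨ window-shift tri s k ⟩
    iter fwdStep k (window f s)         ≡⟨ cong (iter fwdStep k) (combine-unit a b c) ⟩
    iter fwdStep k (combine a b c e₀ e₁ e₂) ≡⟨ iter-fwdStep-combine k a b c e₀ e₁ e₂ ⟩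
    combine a b c (iter fwdStep k e₀) (iter fwdStep k e₁) (iter fwdStep k e₂) ∎)

  tribonacci-identity₁ : f (s + + 1) ≡ - (+ 103) * f (s + + 17) + (+ 56) * f (s + + 18)
  tribonacci-identity₁ = begin
    b                                                                    ≡⟨ certificate a b c ⟩
    - (+ 103) * (a * + 3136 + b * + 4841 + c * + 5768)
      + (+ 56) * (a * + 5768 + b * + 8904 + c * + 10609)                 ≡⟨ cong₂ (λ x y → - (+ 103) * x + (+ 56) * y)
                                                                              (tribonacci-expansion 17) (tribonacci-expansion 18) ⟨
    - (+ 103) * f (s + + 17) + (+ 56) * f (s + + 18)                     ∎
    where
    certificate : ∀ a b c → b ≡ - (+ 103) * (a * + 3136 + b * + 4841 + c * + 5768)
                                + (+ 56) * (a * + 5768 + b * + 8904 + c * + 10609)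
    certificate = solve-∀

  tribonacci-identity₂ : (+ 2) * f s ≡ (+ 9) * f (s + + 17) - (+ 103) * f (s + + 13)
  tribonacci-identity₂ = begin
    (+ 2) * a                                                            ≡⟨ certificate a b c ⟩
    (+ 9) * (a * + 3136 + b * + 4841 + c * + 5768)
      - (+ 103) * (a * + 274 + b * + 423 + c * + 504)                    ≡⟨ cong₂ (λ x y → (+ 9) * x - (+ 103) * y)
                                                                              (tribonacci-expansion 17) (tribonacci-expansion 13) ⟨
    (+ 9) * f (s + + 17) - (+ 103) * f (s + + 13)                        ∎
    where
    certificate : ∀ a b c → (+ 2) * a ≡ (+ 9) * (a * + 3136 + b * + 4841 + c * + 5768)
                                      - (+ 103) * (a * + 274 + b * + 423 + c * + 504)
    certificate = solve-∀

  tribonacci-identity₃ : f (s + + 3) ≡ (+ 9) * f (s + + 19) - (+ 56) * f (s + + 16)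
  tribonacci-identity₃ = begin
    f (s + + 3)                                                          ≡⟨ tri s ⟩
    c + b + a                                                            ≡⟨ certificate a b c ⟩
    (+ 9) * (a * + 10609 + b * + 16377 + c * + 19513)
      - (+ 56) * (a * + 1705 + b * + 2632 + c * + 3136)                  ≡⟨ cong₂ (λ x y → (+ 9) * x - (+ 56) * y)
                                                                              (tribonacci-expansion 19) (tribonacci-expansion 16) ⟨
    (+ 9) * f (s + + 19) - (+ 56) * f (s + + 16)                         ∎
    where
    certificate : ∀ a b c → c + b + a ≡ (+ 9) * (a * + 10609 + b * + 16377 + c * + 19513)
                                       - (+ 56) * (a * + 1705 + b * + 2632 + c * + 3136)
    certificate = solve-∀

shift-by-17 : ∀ r k → r - + 17 + + k ≡ r + (+ k - + 17)
shift-by-17 r k = trans (ℤ.+-assoc r (- + 17) (+ k)) (cong (_+_ r) (ℤ.+-comm (- + 17) (+ k)))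

mainTheorem3 : (W₀ W₁ W₂ : ℤ) → ¬ (W₀ ≡ + 0 × W₁ ≡ + 0 × W₂ ≡ + 0) → (r : ℤ) →
    let W = trib W₀ W₁ W₂ in
    (W (r - + 16) ≡ - (+ 103) * W r + (+ 56) * W (r + + 1))
    × ((+ 2) * W (r - + 17) ≡ (+ 9) * W r - (+ 103) * W (r - + 4))
    × (W (r - + 14) ≡ (+ 9) * W (r + + 2) - (+ 56) * W (r - + 1))
mainTheorem3 W₀ W₁ W₂ _ r =
    trans (sym (at 1)) (trans (tribonacci-identity₁ W tri s) (cong₂ (λ x y → - (+ 103) * x + (+ 56) * y) at-17 (at 18)))
  , trans (tribonacci-identity₂ W tri s) (cong₂ (λ x y → (+ 9) * x - (+ 103) * y) at-17 (at 13))
  , trans (sym (at 3)) (trans (tribonacci-identity₃ W tri s) (cong₂ (λ x y → (+ 9) * x - (+ 56) * y) (at 19) (at 16)))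
  where
  W : ℤ → ℤ
  W = trib W₀ W₁ W₂
  tri : Tribonacci W
  tri = trib-tribonacci W₀ W₁ W₂
  s : ℤ
  s = r - + 17
  -- For a literal k the index r + (+ k - + 17) normalises to the one in the statement.
  at : ∀ k → W (s + + k) ≡ W (r + (+ k - + 17))
  at k = cong W (shift-by-17 r k)
  at-17 : W (s + + 17) ≡ W r
  at-17 = trans (at 17) (cong W (ℤ.+-identityʳ r))
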